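{- Let $n$ and $a$ be relatively prime positive integers and $s\ge1$, and assume the Euclidean algorithm with $n$ and $a$ (in the generalized sense described in the context) produces the symmetric sequence of quotients $q_1,\ldots,q_s,q_s,\ldots,q_1$, with remainders $r_1=n,r_2=a,r_3,\ldots,r_{2s+1}=1,r_{2s+2}=0$. If $i$ and $j$ are integers with $0\le j\le i\le s$, then $$r_{i-j+1}r_{i+j+1}+r_{2s+2-i-j}r_{2s+2-i+j}=n\cdot\mathfrak{r}^+_{i,j},$$ $$r_{i-j+1}r_{i+j+2}-r_{2s+1-i-j}r_{2s+2-i+j}=n\cdot\mathfrak{r}^-_{i,j},$$ where $\mathfrak{r}^+_{i,j}$ and $\mathfrak{r}^-_{i,j}$ are the $(2j+1)$th and $(2j+2)$th remainders, respectively, of the Euclidean algorithm performed with the reduced numerator and denominator of the symmetric continued fraction $[q_{i-j+1},\ldots,q_s,q_s,\ldots,q_{i-j+1}]$.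
   Context: Generalized Euclidean algorithm: for a finite sequence $(u_1,\ldots,u_m)$ ($m\ge0$) of positive integers, its remainders are $\rho_1,\ldots,\rho_{m+2}$ defined by $\rho_{m+2}=0$, $\rho_{m+1}=1$, $\rho_k=u_k\rho_{k+1}+\rho_{k+2}$ for $1\le k\le m$; the $k$th remainder is $\rho_k$. For $m\ge1$, $\rho_1/\rho_2$ equals the simple continued fraction $[u_1,\ldots,u_m]=u_1+\cfrac{1}{u_2+\cfrac{1}{\ddots+\cfrac{1}{u_m}}}$ in lowest terms, and $\rho_1,\rho_2$ are its reduced numerator and denominator; the Euclidean algorithm performed with them (allowing, by convention, the last quotient to be $1$: an ordinary final step $r_l=q_l\cdot1+0$ may be rewritten as $r_l=(q_l-1)\cdot1+1$, $1=1\cdot1+0$) has quotients $u_1,\ldots,u_m$ and remainders $\rho_1,\ldots,\rho_{m+2}$. For the empty sequence ($m=0$), the remainders are $\rho_1=1,\rho_2=0$. "The Euclidean algorithm with $n$ and $a$ produces quotients $(u_1,\ldots,u_m)$" means $n=\rho_1$, $a=\rho_2$ for that sequence, with remainders $r_k=\rho_k$. -}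

module Defs where

open import Data.Nat using (ℕ; zero; suc; _+_; _*_)
open import Data.List using (List; []; _∷_)

-- Remainders of the generalized Euclidean algorithm for a quotient sequence
-- (u₁,…,u_m):  rem u k = ρ_k  for 1 ≤ k ≤ m+2, where
--   ρ_{m+2} = 0, ρ_{m+1} = 1, ρ_k = u_k ρ_{k+1} + ρ_{k+2}.
-- Recursion on the list: ρ_1(u ∷ us) = u·ρ_1(us) + ρ_2(us) and
-- ρ_k(u ∷ us) = ρ_{k-1}(us) for k ≥ 2.  Index 0 and indices > m+2 are junk (0).
rem : List ℕ → ℕ → ℕ
rem []       (suc zero)          = 1
rem []       _                   = 0
rem (u ∷ us) zero                = 0
rem (u ∷ us) (suc zero)          = u * rem us 1 + rem us 2
rem (u ∷ us) (suc (suc k))       = rem us (suc k)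

-- Encode quotients u₁,…,u_m by the continuant matrix K(u) = Π [[u_k,1],[1,0]]: its first column
-- is (ρ₁, ρ₂), and the remainders of xs ++ ys just past position |xs| form the first column of
-- K(ys).  Write the symmetric sequence as p ++ T ++ reverse p with T = t ++ reverse t, and split
-- T = W ++ V with |W| = 2j.  Then K(qs ++ reverse qs) = P S Pᵀ with P = K(p) and S = K(T) = Q R,
-- where S is symmetric (T is a palindrome) and det R = 1 (V has even length), so Q = S adj R.
-- Every remainder occurring in the two identities is an entry of S Pᵀ, R Pᵀ, P Q, P, P S Pᵀ or R,
-- and after substituting Q = S adj R both identities become polynomial identities in the entries
-- of P, S and R.
module Submission where

open import Defs
open import Data.Nat as ℕ using (ℕ; suc)
open import Data.Nat.Coprimality using (Coprime)
open import Data.List using (List; []; _∷_; [_]; length; _++_; reverse; take; drop)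
open import Data.List.Properties
  using (unfold-reverse; ++-assoc; reverse-++; reverse-involutive; length-++; length-reverse;
         length-take; length-drop; take++drop≡id)
open import Data.List.Relation.Unary.All using (All)
open import Data.Product using (_×_; _,_)
open import Relation.Binary.PropositionalEquality
  using (_≡_; refl; sym; trans; cong; cong₂; subst; module ≡-Reasoning)

module IntegerMatrix where
  open import Data.Integer using (ℤ; -_; _+_; _-_; _*_; 0ℤ; 1ℤ)
  open import Data.Integer.Tactic.RingSolver using (solve-∀)

  data Mat : Set where
    mat : (a b c d : ℤ) → Mat

  m₁₁ m₁₂ m₂₁ : Mat → ℤ
  m₁₁ (mat a _ _ _) = a
  m₁₂ (mat _ b _ _) = b
  m₂₁ (mat _ _ c _) = c

  infixl 7 _·_
  infix  8 _ᵀ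

  _·_ : Mat → Mat → Mat
  mat a b c d · mat e f g h = mat (a * e + b * g) (a * f + b * h) (c * e + d * g) (c * f + d * h)

  _ᵀ : Mat → Mat
  mat a b c d ᵀ = mat a c b d

  adj : Mat → Mat
  adj (mat a b c d) = mat d (- b) (- c) a

  det : Mat → ℤ
  det (mat a b c d) = a * d - b * c

  I : Mat
  I = mat 1ℤ 0ℤ 0ℤ 1ℤ

  mat-cong : ∀ {a b c d a′ b′ c′ d′} → a ≡ a′ → b ≡ b′ → c ≡ c′ → d ≡ d′ →
             mat a b c d ≡ mat a′ b′ c′ d′
  mat-cong refl refl refl refl = refl

  private
    assoc-entry : ∀ x y e f g h i k →
      (x * e + y * g) * i + (x * f + y * h) * k ≡ x * (e * i + f * k) + y * (g * i + h * k)
    assoc-entry = solve-∀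

    unit-entry₁ : ∀ x y → 1ℤ * x + 0ℤ * y ≡ x
    unit-entry₁ = solve-∀

    unit-entry₂ : ∀ x y → 0ℤ * x + 1ℤ * y ≡ y
    unit-entry₂ = solve-∀

    unit-entry₁′ : ∀ x y → x * 1ℤ + y * 0ℤ ≡ x
    unit-entry₁′ = solve-∀

    unit-entry₂′ : ∀ x y → x * 0ℤ + y * 1ℤ ≡ y
    unit-entry₂′ = solve-∀

    transpose-entry : ∀ x y e g → x * e + y * g ≡ e * x + g * y
    transpose-entry = solve-∀

    det-product : ∀ a b c d e f g h →
      (a * e + b * g) * (c * f + d * h) - (a * f + b * h) * (c * e + d * g)
        ≡ (a * d - b * c) * (e * h - f * g)
    det-product = solve-∀

    adj-diagonal₁ : ∀ a b c d → a * d + b * - c ≡ a * d - b * c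
    adj-diagonal₁ = solve-∀

    adj-diagonal₂ : ∀ a b c d → c * - b + d * a ≡ a * d - b * c
    adj-diagonal₂ = solve-∀

    adj-off-diagonal₁ : ∀ x y → x * - y + y * x ≡ 0ℤ
    adj-off-diagonal₁ = solve-∀

    adj-off-diagonal₂ : ∀ x y → x * y + y * - x ≡ 0ℤ
    adj-off-diagonal₂ = solve-∀

    sandwich-polynomial₊ : ∀ p₁ p₂ a b c r₁ r₂ →
      (a * p₁ + b * p₂) * (r₁ * p₁ + r₂ * p₂)
        + (p₁ * (a * - r₂ + b * r₁) + p₂ * (b * - r₂ + c * r₁)) * p₂
        ≡ ((p₁ * a + p₂ * b) * p₁ + (p₁ * b + p₂ * c) * p₂) * r₁
    sandwich-polynomial₊ = solve-∀

    sandwich-polynomial₋ : ∀ p₁ p₂ a b c r₃ r₄ →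
      (a * p₁ + b * p₂) * (r₃ * p₁ + r₄ * p₂)
        - (p₁ * (a * r₄ + b * - r₃) + p₂ * (b * r₄ + c * - r₃)) * p₂
        ≡ ((p₁ * a + p₂ * b) * p₁ + (p₁ * b + p₂ * c) * p₂) * r₃
    sandwich-polynomial₋ = solve-∀

  ·-assoc : ∀ A B C → A · B · C ≡ A · (B · C)
  ·-assoc (mat a b c d) (mat e f g h) (mat i j k l) =
    mat-cong (assoc-entry a b e f g h i k) (assoc-entry a b e f g h j l)
             (assoc-entry c d e f g h i k) (assoc-entry c d e f g h j l)

  ·-identityˡ : ∀ A → I · A ≡ A
  ·-identityˡ (mat a b c d) =
    mat-cong (unit-entry₁ a c) (unit-entry₁ b d) (unit-entry₂ a c) (unit-entry₂ b d)

  ·-identityʳ : ∀ A → A · I ≡ A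
  ·-identityʳ (mat a b c d) =
    mat-cong (unit-entry₁′ a b) (unit-entry₂′ a b) (unit-entry₁′ c d) (unit-entry₂′ c d)

  ᵀ-· : ∀ A B → (A · B) ᵀ ≡ B ᵀ · A ᵀ
  ᵀ-· (mat a b c d) (mat e f g h) =
    mat-cong (transpose-entry a b e g) (transpose-entry c d e g)
             (transpose-entry a b f h) (transpose-entry c d f h)

  m₁₁-ᵀ : ∀ A → m₁₁ (A ᵀ) ≡ m₁₁ A
  m₁₁-ᵀ (mat _ _ _ _) = refl

  m₂₁-ᵀ : ∀ A → m₂₁ (A ᵀ) ≡ m₁₂ A
  m₂₁-ᵀ (mat _ _ _ _) = refl

  det-· : ∀ A B → det (A · B) ≡ det A * det B
  det-· (mat a b c d) (mat e f g h) = det-product a b c d e f g h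

  det≡1⇒·adj≡I : ∀ A → det A ≡ 1ℤ → A · adj A ≡ I
  det≡1⇒·adj≡I (mat a b c d) det≡1 =
    mat-cong (trans (adj-diagonal₁ a b c d) det≡1) (adj-off-diagonal₁ a b)
             (adj-off-diagonal₂ c d) (trans (adj-diagonal₂ a b c d) det≡1)

  ·-adj-cancelʳ : ∀ A B → det B ≡ 1ℤ → A · B · adj B ≡ A
  ·-adj-cancelʳ A B det≡1 = begin
    A · B · adj B   ≡⟨ ·-assoc A B (adj B) ⟩
    A · (B · adj B) ≡⟨ cong (A ·_) (det≡1⇒·adj≡I B det≡1) ⟩
    A · I           ≡⟨ ·-identityʳ A ⟩
    A               ∎
    where open ≡-Reasoning

  symmetric-sandwich₊ : ∀ P S R → S ᵀ ≡ S →
    m₁₁ (S · P ᵀ) * m₁₁ (R · P ᵀ) + m₁₂ (P · (S · adj R)) * m₁₂ P ≡ m₁₁ (P · S · P ᵀ) * m₁₁ R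
  symmetric-sandwich₊ (mat p₁ p₂ _ _) (mat a b .b c) (mat r₁ r₂ _ _) refl =
    sandwich-polynomial₊ p₁ p₂ a b c r₁ r₂

  symmetric-sandwich₋ : ∀ P S R → S ᵀ ≡ S →
    m₁₁ (S · P ᵀ) * m₂₁ (R · P ᵀ) - m₁₁ (P · (S · adj R)) * m₁₂ P ≡ m₁₁ (P · S · P ᵀ) * m₂₁ R
  symmetric-sandwich₋ (mat p₁ p₂ _ _) (mat a b .b c) (mat _ _ r₃ r₄) refl =
    sandwich-polynomial₋ p₁ p₂ a b c r₃ r₄

  sandwich₊ : ∀ P Q R → (Q · R) ᵀ ≡ Q · R → det R ≡ 1ℤ →
    m₁₁ (Q · R · P ᵀ) * m₁₁ (R · P ᵀ) + m₁₂ (P · Q) * m₁₂ P ≡ m₁₁ (P · (Q · R) · P ᵀ) * m₁₁ R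
  sandwich₊ P Q R QR-symmetric det≡1 =
    trans (cong (λ X → left + m₁₂ (P · X) * m₁₂ P) (sym (·-adj-cancelʳ Q R det≡1)))
          (symmetric-sandwich₊ P (Q · R) R QR-symmetric)
    where left = m₁₁ (Q · R · P ᵀ) * m₁₁ (R · P ᵀ)

  sandwich₋ : ∀ P Q R → (Q · R) ᵀ ≡ Q · R → det R ≡ 1ℤ →
    m₁₁ (Q · R · P ᵀ) * m₂₁ (R · P ᵀ) - m₁₁ (P · Q) * m₁₂ P ≡ m₁₁ (P · (Q · R) · P ᵀ) * m₂₁ R
  sandwich₋ P Q R QR-symmetric det≡1 =
    trans (cong (λ X → left - m₁₁ (P · X) * m₁₂ P) (sym (·-adj-cancelʳ Q R det≡1)))
          (symmetric-sandwich₋ P (Q · R) R QR-symmetric)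
    where left = m₁₁ (Q · R · P ᵀ) * m₂₁ (R · P ᵀ)

module Continuant where
  open import Data.Integer using (+_; _+_; _-_; _*_; _^_; 0ℤ; 1ℤ; -1ℤ)
  open import Data.Integer.Properties using (pos-+; pos-*; *-zeroʳ; ^-*-assoc; ^-zeroˡ)
  open import Data.Integer.Tactic.RingSolver using (solve-∀)
  open IntegerMatrix

  step : ℕ → Mat
  step u = mat (+ u) 1ℤ 1ℤ 0ℤ

  continuant : List ℕ → Mat
  continuant []       = I
  continuant (u ∷ us) = step u · continuant us

  continuant-++ : ∀ xs ys → continuant (xs ++ ys) ≡ continuant xs · continuant ys
  continuant-++ []       ys = sym (·-identityˡ (continuant ys))
  continuant-++ (x ∷ xs) ys = begin
    step x · continuant (xs ++ ys)           ≡⟨ cong (step x ·_) (continuant-++ xs ys) ⟩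
    step x · (continuant xs · continuant ys) ≡⟨ ·-assoc (step x) (continuant xs) (continuant ys) ⟨
    step x · continuant xs · continuant ys   ∎
    where open ≡-Reasoning

  continuant-reverse : ∀ xs → continuant (reverse xs) ≡ continuant xs ᵀ
  continuant-reverse []       = refl
  continuant-reverse (x ∷ xs) = begin
    continuant (reverse (x ∷ xs))          ≡⟨ cong continuant (unfold-reverse x xs) ⟩
    continuant (reverse xs ++ [ x ])       ≡⟨ continuant-++ (reverse xs) [ x ] ⟩
    continuant (reverse xs) · (step x · I)
      ≡⟨ cong₂ _·_ (continuant-reverse xs) (·-identityʳ (step x)) ⟩
    continuant xs ᵀ · step x ᵀ             ≡⟨ ᵀ-· (step x) (continuant xs) ⟨
    (step x · continuant xs) ᵀ             ∎
    where open ≡-Reasoning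

  det-continuant : ∀ xs → det (continuant xs) ≡ -1ℤ ^ length xs
  det-continuant []       = refl
  det-continuant (x ∷ xs) = begin
    det (step x · continuant xs)       ≡⟨ det-· (step x) (continuant xs) ⟩
    det (step x) * det (continuant xs) ≡⟨ cong₂ _*_ det-step (det-continuant xs) ⟩
    -1ℤ * -1ℤ ^ length xs              ∎
    where
    open ≡-Reasoning
    det-step : det (step x) ≡ -1ℤ
    det-step = cong (_- 1ℤ * 1ℤ) (*-zeroʳ (+ x))

  det-continuant-even : ∀ xs k → length xs ≡ 2 ℕ.* k → det (continuant xs) ≡ 1ℤ
  det-continuant-even xs k |xs| = begin
    det (continuant xs) ≡⟨ det-continuant xs ⟩
    -1ℤ ^ length xs     ≡⟨ cong (-1ℤ ^_) |xs| ⟩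
    -1ℤ ^ (2 ℕ.* k)     ≡⟨ ^-*-assoc -1ℤ 2 k ⟨
    1ℤ ^ k              ≡⟨ ^-zeroˡ k ⟩
    1ℤ                  ∎
    where open ≡-Reasoning

  private
    first-entry : ∀ x a c → x * a + 1ℤ * c ≡ x * a + c
    first-entry = solve-∀

    second-entry : ∀ a c → 1ℤ * a + 0ℤ * c ≡ a
    second-entry = solve-∀

  m₁₁-step-· : ∀ u A → m₁₁ (step u · A) ≡ + u * m₁₁ A + m₂₁ A
  m₁₁-step-· u (mat a _ c _) = first-entry (+ u) a c

  m₂₁-step-· : ∀ u A → m₂₁ (step u · A) ≡ m₁₁ A
  m₂₁-step-· u (mat a _ c _) = second-entry a c

  rem₁-continuant : ∀ xs → + rem xs 1 ≡ m₁₁ (continuant xs)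
  rem₂-continuant : ∀ xs → + rem xs 2 ≡ m₂₁ (continuant xs)

  rem₁-continuant []       = refl
  rem₁-continuant (u ∷ us) = begin
    + (u ℕ.* rem us 1 ℕ.+ rem us 2) ≡⟨ pos-+ (u ℕ.* rem us 1) (rem us 2) ⟩
    + (u ℕ.* rem us 1) + + rem us 2 ≡⟨ cong (_+ + rem us 2) (pos-* u (rem us 1)) ⟩
    + u * + rem us 1 + + rem us 2
      ≡⟨ cong₂ (λ x y → + u * x + y) (rem₁-continuant us) (rem₂-continuant us) ⟩
    + u * m₁₁ C + m₂₁ C             ≡⟨ m₁₁-step-· u C ⟨
    m₁₁ (step u · C)                ∎
    where
    open ≡-Reasoning
    C = continuant us

  rem₂-continuant []       = refl
  rem₂-continuant (u ∷ us) = trans (rem₁-continuant us) (sym (m₂₁-step-· u (continuant us)))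

open IntegerMatrix
open Continuant
open import Data.Nat using (_+_; _*_; _∸_; _≤_; _<_)
open import Data.Nat.Properties
  using (≤-trans; +-suc; +-assoc; ∸-+-assoc; m+n∸n≡m; m+n∸m≡n; m≤m+n; m≤n⇒m⊓n≡m;
         m∸n+n≡m; m+[n∸m]≡n)
open import Data.Nat.Tactic.RingSolver using (solve)
open import Data.Integer as ℤ using (+_; _-_; 1ℤ) renaming (_*_ to _*ℤ_)
open import Data.Integer.Properties using (pos-+; pos-*; +-injective)

length-take-≤ : ∀ {A : Set} {n} (xs : List A) → n ≤ length xs → length (take n xs) ≡ n
length-take-≤ {n = n} xs n≤|xs| = trans (length-take n xs) (m≤n⇒m⊓n≡m n≤|xs|)

++-reverse-palindrome : ∀ {A : Set} (xs : List A) → xs ++ reverse xs ≡ reverse (xs ++ reverse xs)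
++-reverse-palindrome xs = begin
  xs ++ reverse xs                   ≡⟨ cong (_++ reverse xs) (reverse-involutive xs) ⟨
  reverse (reverse xs) ++ reverse xs ≡⟨ reverse-++ xs (reverse xs) ⟨
  reverse (xs ++ reverse xs)         ∎
  where open ≡-Reasoning

++-reverse-split : ∀ {A : Set} k (xs : List A) →
  xs ++ reverse xs ≡ take k xs ++ (drop k xs ++ reverse (drop k xs)) ++ reverse (take k xs)
++-reverse-split k xs = begin
  xs ++ reverse xs                   ≡⟨ cong (λ ys → ys ++ reverse ys) (take++drop≡id k xs) ⟨
  (p ++ t) ++ reverse (p ++ t)       ≡⟨ cong ((p ++ t) ++_) (reverse-++ p t) ⟩
  (p ++ t) ++ reverse t ++ reverse p ≡⟨ ++-assoc p t _ ⟩
  p ++ t ++ reverse t ++ reverse p   ≡⟨ cong (p ++_) (++-assoc t (reverse t) (reverse p)) ⟨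
  p ++ (t ++ reverse t) ++ reverse p ∎
  where
  open ≡-Reasoning
  p = take k xs
  t = drop k xs

rem-++ : ∀ xs ys k → rem (xs ++ ys) (suc (length xs + k)) ≡ rem ys (suc k)
rem-++ []       ys k = refl
rem-++ (x ∷ xs) ys k = rem-++ xs ys k

rem-after : ∀ {zs} xs ys {k} i → zs ≡ xs ++ ys → length xs ≡ k →
            rem zs (k + suc i) ≡ rem ys (suc i)
rem-after xs ys i refl refl = trans (cong (rem (xs ++ ys)) (+-suc (length xs) i)) (rem-++ xs ys i)

rem-after₁ : ∀ {zs} xs ys {k} → zs ≡ xs ++ ys → length xs ≡ k →
             + rem zs (k + 1) ≡ m₁₁ (continuant ys)
rem-after₁ xs ys split |xs| = trans (cong +_ (rem-after xs ys 0 split |xs|)) (rem₁-continuant ys)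

rem-after₂ : ∀ {zs} xs ys {k} → zs ≡ xs ++ ys → length xs ≡ k →
             + rem zs (k + 2) ≡ m₂₁ (continuant ys)
rem-after₂ xs ys split |xs| = trans (cong +_ (rem-after xs ys 1 split |xs|)) (rem₂-continuant ys)

module Palindrome (p T : List ℕ) {d w f : ℕ} (|p| : length p ≡ d)
                  (|T| : length T ≡ w + 2 * f) (T-palindrome : T ≡ reverse T) where

  private
    L W V : List ℕ
    L = p ++ T ++ reverse p
    W = take w T
    V = drop w T

    P Q R : Mat
    P = continuant p
    Q = continuant W
    R = continuant V

    W++V≡T : W ++ V ≡ T
    W++V≡T = take++drop≡id w T

    |W| : length W ≡ w
    |W| = length-take-≤ T (subst (w ≤_) (sym |T|) (m≤m+n w (2 * f)))

    |V| : length V ≡ 2 * f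
    |V| = trans (length-drop w T) (trans (cong (_∸ w) |T|) (m+n∸m≡n w (2 * f)))

    continuant-T : continuant T ≡ Q · R
    continuant-T = trans (cong continuant (sym W++V≡T)) (continuant-++ W V)

    QR-symmetric : (Q · R) ᵀ ≡ Q · R
    QR-symmetric = begin
      (Q · R) ᵀ              ≡⟨ cong _ᵀ continuant-T ⟨
      continuant T ᵀ         ≡⟨ continuant-reverse T ⟨
      continuant (reverse T) ≡⟨ cong continuant T-palindrome ⟨
      continuant T           ≡⟨ continuant-T ⟩
      Q · R                  ∎
      where open ≡-Reasoning

    det-R : det R ≡ 1ℤ
    det-R = det-continuant-even V f |V|

    L-split-W : L ≡ (p ++ W) ++ (V ++ reverse p)
    L-split-W = begin
      p ++ T ++ reverse p        ≡⟨ cong (λ X → p ++ X ++ reverse p) W++V≡T ⟨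
      p ++ (W ++ V) ++ reverse p ≡⟨ cong (p ++_) (++-assoc W V (reverse p)) ⟩
      p ++ W ++ V ++ reverse p   ≡⟨ ++-assoc p W (V ++ reverse p) ⟨
      (p ++ W) ++ V ++ reverse p ∎
      where open ≡-Reasoning

    L-split-V : L ≡ (p ++ reverse V) ++ (reverse W ++ reverse p)
    L-split-V = begin
      p ++ T ++ reverse p                        ≡⟨ cong (λ X → p ++ X ++ reverse p) T≡rV++rW ⟩
      p ++ (reverse V ++ reverse W) ++ reverse p
        ≡⟨ cong (p ++_) (++-assoc (reverse V) (reverse W) (reverse p)) ⟩
      p ++ reverse V ++ reverse W ++ reverse p   ≡⟨ ++-assoc p (reverse V) _ ⟨
      (p ++ reverse V) ++ reverse W ++ reverse p ∎
      where
      open ≡-Reasoning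
      T≡rV++rW : T ≡ reverse V ++ reverse W
      T≡rV++rW = trans T-palindrome (trans (cong reverse (sym W++V≡T)) (reverse-++ W V))

    |p++W| : length (p ++ W) ≡ d + w
    |p++W| = trans (length-++ p) (cong₂ _+_ |p| |W|)

    |p++rV| : length (p ++ reverse V) ≡ d + 2 * f
    |p++rV| = trans (length-++ p) (cong₂ _+_ |p| (trans (length-reverse V) |V|))

    |p++T| : length (p ++ T) ≡ d + w + 2 * f
    |p++T| = trans (length-++ p) (trans (cong₂ _+_ |p| |T|) (sym (+-assoc d w (2 * f))))

    continuant-T-rp : continuant (T ++ reverse p) ≡ Q · R · P ᵀ
    continuant-T-rp = trans (continuant-++ T (reverse p))
                            (cong₂ _·_ continuant-T (continuant-reverse p))

    continuant-V-rp : continuant (V ++ reverse p) ≡ R · P ᵀ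
    continuant-V-rp = trans (continuant-++ V (reverse p)) (cong (R ·_) (continuant-reverse p))

    continuant-rW-rp : continuant (reverse W ++ reverse p) ≡ (P · Q) ᵀ
    continuant-rW-rp = begin
      continuant (reverse W ++ reverse p)             ≡⟨ continuant-++ (reverse W) (reverse p) ⟩
      continuant (reverse W) · continuant (reverse p)
        ≡⟨ cong₂ _·_ (continuant-reverse W) (continuant-reverse p) ⟩
      Q ᵀ · P ᵀ                                       ≡⟨ ᵀ-· P Q ⟨
      (P · Q) ᵀ                                       ∎
      where open ≡-Reasoning

    continuant-L : continuant L ≡ P · (Q · R) · P ᵀ
    continuant-L = begin
      continuant (p ++ T ++ reverse p) ≡⟨ continuant-++ p (T ++ reverse p) ⟩
      P · continuant (T ++ reverse p)  ≡⟨ cong (P ·_) continuant-T-rp ⟩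
      P · (Q · R · P ᵀ)                ≡⟨ ·-assoc P (Q · R) (P ᵀ) ⟨
      P · (Q · R) · P ᵀ                ∎
      where open ≡-Reasoning

    rem-L-1 : + rem L 1 ≡ m₁₁ (P · (Q · R) · P ᵀ)
    rem-L-1 = trans (rem₁-continuant L) (cong m₁₁ continuant-L)

    rem-L-d : + rem L (d + 1) ≡ m₁₁ (Q · R · P ᵀ)
    rem-L-d = trans (rem-after₁ p (T ++ reverse p) refl |p|) (cong m₁₁ continuant-T-rp)

    rem-L-dw₁ : + rem L (d + w + 1) ≡ m₁₁ (R · P ᵀ)
    rem-L-dw₁ = trans (rem-after₁ (p ++ W) (V ++ reverse p) L-split-W |p++W|)
                      (cong m₁₁ continuant-V-rp)

    rem-L-dw₂ : + rem L (d + w + 2) ≡ m₂₁ (R · P ᵀ)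
    rem-L-dw₂ = trans (rem-after₂ (p ++ W) (V ++ reverse p) L-split-W |p++W|)
                      (cong m₂₁ continuant-V-rp)

    rem-L-df₁ : + rem L (d + 2 * f + 1) ≡ m₁₁ (P · Q)
    rem-L-df₁ = trans (rem-after₁ (p ++ reverse V) (reverse W ++ reverse p) L-split-V |p++rV|)
                      (trans (cong m₁₁ continuant-rW-rp) (m₁₁-ᵀ (P · Q)))

    rem-L-df₂ : + rem L (d + 2 * f + 2) ≡ m₁₂ (P · Q)
    rem-L-df₂ = trans (rem-after₂ (p ++ reverse V) (reverse W ++ reverse p) L-split-V |p++rV|)
                      (trans (cong m₂₁ continuant-rW-rp) (m₂₁-ᵀ (P · Q)))

    rem-L-dwf : + rem L (d + w + 2 * f + 2) ≡ m₁₂ P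
    rem-L-dwf = trans (rem-after₂ (p ++ T) (reverse p) (sym (++-assoc p T (reverse p))) |p++T|)
                      (trans (cong m₂₁ (continuant-reverse p)) (m₂₁-ᵀ P))

    rem-T-w₁ : + rem T (w + 1) ≡ m₁₁ R
    rem-T-w₁ = rem-after₁ W V (sym W++V≡T) |W|

    rem-T-w₂ : + rem T (w + 2) ≡ m₂₁ R
    rem-T-w₂ = rem-after₂ W V (sym W++V≡T) |W|

  rem-identity₊ :
    rem L (d + 1) * rem L (d + w + 1) + rem L (d + 2 * f + 2) * rem L (d + w + 2 * f + 2)
      ≡ rem L 1 * rem T (w + 1)
  rem-identity₊ = +-injective (begin
    + (rem L (d + 1) * rem L (d + w + 1) + rem L (d + 2 * f + 2) * rem L (d + w + 2 * f + 2))
      ≡⟨ pos-+ (rem L (d + 1) * _) _ ⟩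
    + (rem L (d + 1) * rem L (d + w + 1)) ℤ.+ + (rem L (d + 2 * f + 2) * rem L (d + w + 2 * f + 2))
      ≡⟨ cong₂ ℤ._+_ (pos-* (rem L (d + 1)) _) (pos-* (rem L (d + 2 * f + 2)) _) ⟩
    + rem L (d + 1) *ℤ + rem L (d + w + 1) ℤ.+ + rem L (d + 2 * f + 2) *ℤ + rem L (d + w + 2 * f + 2)
      ≡⟨ cong₂ ℤ._+_ (cong₂ _*ℤ_ rem-L-d rem-L-dw₁) (cong₂ _*ℤ_ rem-L-df₂ rem-L-dwf) ⟩
    m₁₁ (Q · R · P ᵀ) *ℤ m₁₁ (R · P ᵀ) ℤ.+ m₁₂ (P · Q) *ℤ m₁₂ P
      ≡⟨ sandwich₊ P Q R QR-symmetric det-R ⟩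
    m₁₁ (P · (Q · R) · P ᵀ) *ℤ m₁₁ R
      ≡⟨ cong₂ _*ℤ_ rem-L-1 rem-T-w₁ ⟨
    + rem L 1 *ℤ + rem T (w + 1)
      ≡⟨ pos-* (rem L 1) (rem T (w + 1)) ⟨
    + (rem L 1 * rem T (w + 1)) ∎)
    where open ≡-Reasoning

  rem-identity₋ :
    + (rem L (d + 1) * rem L (d + w + 2)) - + (rem L (d + 2 * f + 1) * rem L (d + w + 2 * f + 2))
      ≡ + rem L 1 *ℤ + rem T (w + 2)
  rem-identity₋ = begin
    + (rem L (d + 1) * rem L (d + w + 2)) - + (rem L (d + 2 * f + 1) * rem L (d + w + 2 * f + 2))
      ≡⟨ cong₂ _-_ (pos-* (rem L (d + 1)) _) (pos-* (rem L (d + 2 * f + 1)) _) ⟩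
    + rem L (d + 1) *ℤ + rem L (d + w + 2) - + rem L (d + 2 * f + 1) *ℤ + rem L (d + w + 2 * f + 2)
      ≡⟨ cong₂ _-_ (cong₂ _*ℤ_ rem-L-d rem-L-dw₂) (cong₂ _*ℤ_ rem-L-df₁ rem-L-dwf) ⟩
    m₁₁ (Q · R · P ᵀ) *ℤ m₂₁ (R · P ᵀ) - m₁₁ (P · Q) *ℤ m₁₂ P
      ≡⟨ sandwich₋ P Q R QR-symmetric det-R ⟩
    m₁₁ (P · (Q · R) · P ᵀ) *ℤ m₂₁ R
      ≡⟨ cong₂ _*ℤ_ rem-L-1 rem-T-w₂ ⟨
    + rem L 1 *ℤ + rem T (w + 2) ∎
    where open ≡-Reasoning

module _ (d j f : ℕ) where
  inner-index : ∀ c → d + j + j + c ≡ d + 2 * j + c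
  inner-index c = solve (d ∷ j ∷ c ∷ [])

  outer-index : ∀ c → 2 * (d + j + f) + c ∸ (d + j) ∸ j ≡ d + 2 * f + c
  outer-index c = begin
    2 * (d + j + f) + c ∸ (d + j) ∸ j         ≡⟨ ∸-+-assoc (2 * (d + j + f) + c) (d + j) j ⟩
    2 * (d + j + f) + c ∸ (d + j + j)         ≡⟨ cong (_∸ (d + j + j)) rearrange ⟩
    d + 2 * f + c + (d + j + j) ∸ (d + j + j) ≡⟨ m+n∸n≡m (d + 2 * f + c) (d + j + j) ⟩
    d + 2 * f + c                             ∎
    where
    open ≡-Reasoning
    rearrange : 2 * (d + j + f) + c ≡ d + 2 * f + c + (d + j + j)
    rearrange = solve (d ∷ j ∷ f ∷ c ∷ [])

  last-index : 2 * (d + j + f) + 2 ∸ (d + j) + j ≡ d + 2 * j + 2 * f + 2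
  last-index = begin
    2 * (d + j + f) + 2 ∸ (d + j) + j         ≡⟨ cong (λ m → m ∸ (d + j) + j) rearrange ⟩
    d + j + 2 * f + 2 + (d + j) ∸ (d + j) + j
      ≡⟨ cong (_+ j) (m+n∸n≡m (d + j + 2 * f + 2) (d + j)) ⟩
    d + j + 2 * f + 2 + j                     ≡⟨ solve (d ∷ j ∷ f ∷ []) ⟩
    d + 2 * j + 2 * f + 2                     ∎
    where
    open ≡-Reasoning
    rearrange : 2 * (d + j + f) + 2 ≡ d + j + 2 * f + 2 + (d + j)
    rearrange = solve (d ∷ j ∷ f ∷ [])

-- Positivity, coprimality and the value of a are not needed: the identities hold for every
-- quotient sequence.  Abstracting i ∸ j as d turns i into d + j and s into d + j + f, after which
-- every index is a polynomial in d, j, f.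
theorem2 : (n a s : ℕ) → 0 < n → 0 < a → Coprime n a → 1 ≤ s →
    (qs : List ℕ) → length qs ≡ s → All (λ q → 0 < q) qs →
    n ≡ rem (qs ++ reverse qs) 1 → a ≡ rem (qs ++ reverse qs) 2 →
    (i j : ℕ) → j ≤ i → i ≤ s →
    let r = rem (qs ++ reverse qs)
        t = drop (i ∸ j) qs
        ρ = rem (t ++ reverse t)
    in (r (i ∸ j + 1) * r (i + j + 1) + r (2 * s + 2 ∸ i ∸ j) * r (2 * s + 2 ∸ i + j)
          ≡ n * ρ (2 * j + 1))
     × (+ (r (i ∸ j + 1) * r (i + j + 2)) - + (r (2 * s + 1 ∸ i ∸ j) * r (2 * s + 2 ∸ i + j))
          ≡ + n *ℤ + ρ (2 * j + 2))
theorem2 _ _ s _ _ _ _ qs |qs| _ refl _ i j j≤i i≤s with i ∸ j | m∸n+n≡m j≤i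
... | d | refl with s ∸ (d + j) | m+[n∸m]≡n i≤s
... | f | refl
  rewrite ++-reverse-split d qs | inner-index d j f 1 | inner-index d j f 2
        | outer-index d j f 2 | outer-index d j f 1 | last-index d j f
  = Palindrome.rem-identity₊ p T {f = f} |p| |T| (++-reverse-palindrome t)
  , Palindrome.rem-identity₋ p T {f = f} |p| |T| (++-reverse-palindrome t)
  where
  p t T : List ℕ
  p = take d qs
  t = drop d qs
  T = t ++ reverse t

  |p| : length p ≡ d
  |p| = length-take-≤ qs (subst (d ≤_) (sym |qs|) (≤-trans (m≤m+n d j) (m≤m+n (d + j) f)))

  |t| : length t ≡ j + f
  |t| = trans (length-drop d qs)
              (trans (cong (_∸ d) (trans |qs| (+-assoc d j f))) (m+n∸m≡n d (j + f)))

  |T| : length T ≡ 2 * j + 2 * f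
  |T| = trans (length-++ t)
              (trans (cong₂ _+_ |t| (trans (length-reverse t) |t|)) (solve (j ∷ f ∷ [])))
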